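{- Let $\beta\in\mathfrak S_n$ and $0\le i\le n$. Then $x_{\operatorname{Mc}(1\Cup_i\beta)}=x_{\tau_M(\beta)(i)}\,x_{\operatorname{Mc}(\beta)}$, where $\tau_M(\beta)$ is the permutation of $\{0,\ldots,n\}$ defined as follows: letting $\operatorname{des}(\beta)$ be the number of descents of $\beta$, $\tau_M(\beta)(i)=\operatorname{des}(\beta)-j$ if $i$ is the $j$-th descent of $\beta$, and $\tau_M(\beta)(i)=\operatorname{des}(\beta)+j-1$ if $i$ is the $j$-th rise of $\beta$.
   Context: Permutations are words. A descent of $\beta\in\mathfrak S_n$ is a position $i\in[1,n-1]$ with $\beta(i)>\beta(i+1)$; the rises of $\beta$ are the elements of $\{0,1,\ldots,n\}$ that are not descents (so $0$ and $n$ are rises); descents and rises are numbered from left to right (increasing position). For $\beta\in\mathfrak S_n$ and $0\le i\le n$, $1\Cup_i\beta\in\mathfrak S_{n+1}$ is obtained from $\beta$ by adding $1$ to every letter and inserting the letter $1$ at position $i+1$. Majcode: for a word $w=w_1\cdots w_m$, $\operatorname{maj}(w)=\sum_{j:w_j>w_{j+1}}j$; for $\sigma\in\mathfrak S_m$, $\sigma^{(i)}$ is the subword of letters $\ge i$, and $\operatorname{Mc}(\sigma)=(c_1,\ldots,c_m)$ with $c_m=0$ and $c_i=\operatorname{maj}(\sigma^{(i)})-\operatorname{maj}(\sigma^{(i+1)})$. $x_0,x_1,\ldots$ are commuting indeterminates, $x_c=x_{c_1}\cdots x_{c_m}$. -}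

module Defs where

open import Data.Nat using (ℕ; zero; suc; _+_; _∸_; _<?_; _≤?_; _≟_)
open import Data.Bool using (Bool; true; false; if_then_else_)
open import Data.List using (List; []; _∷_; _++_; map; filter; length; take; drop; upTo; applyUpTo)
open import Data.Nat.ListAction using (sum)
open import Data.List.Membership.DecPropositional _≟_ using (_∈?_; _∉?_)
open import Relation.Nullary using (Dec; yes; no)
open import Relation.Nullary.Decidable using (⌊_⌋)

descentsFrom : ℕ → List ℕ → List ℕ
descentsFrom k []           = []
descentsFrom k (a ∷ [])     = []
descentsFrom k (a ∷ b ∷ w)  =
  if ⌊ b <? a ⌋ then k ∷ descentsFrom (suc k) (b ∷ w) else descentsFrom (suc k) (b ∷ w)

descents : List ℕ → List ℕ
descents w = descentsFrom 1 w

maj : List ℕ → ℕ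
maj w = sum (descents w)

sub≥ : ℕ → List ℕ → List ℕ
sub≥ i σ = filter (λ x → i ≤? x) σ

Mc : List ℕ → List ℕ
Mc σ = map (λ i → maj (sub≥ i σ) ∸ maj (sub≥ (suc i) σ)) (applyUpTo suc (length σ))

ins1 : ℕ → List ℕ → List ℕ
ins1 i β = take i (map suc β) ++ (1 ∷ drop i (map suc β))

idWord : ℕ → List ℕ
idWord n = applyUpTo suc n

des : List ℕ → ℕ
des β = length (descents β)

rises : List ℕ → List ℕ
rises β = filter (λ r → r ∉? descents β) (upTo (suc (length β)))

τM : List ℕ → ℕ → ℕ
τM β i with i ∈? descents β
... | yes _ = des β ∸ length (filter (λ d → d ≤? i) (descents β))
... | no _  = (des β + length (filter (λ r → r ≤? i) (rises β))) ∸ 1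

-- Inserting the new minimal letter 1 into the shifted word β + 1 leaves each subword
-- σ^(k+2) equal to β^(k+1) shifted by one, and shifting letters does not change maj; so every
-- entry of Mc(1 ⋓_i β) but the first is that of Mc(β), and the first is maj(1 ⋓_i β) − maj(β).
-- Inserting a minimum after the first i letters keeps the descents before i, moves those
-- after i one place to the right, and makes i a descent (when i ≥ 1).  Hence maj increases by
-- #{descents > i} when i is a descent and by i + #{descents > i} when i is a rise; since the
-- descents ≤ i and the rises ≤ i together are {0, …, i}, these are the two cases of τ_M(β)(i).

module Submission where

open import Algebra.Properties.CommutativeSemigroup using (xy∙z≈xz∙y)
open import Data.Bool using (true; false; if_then_else_)
open import Data.List using (List; []; _∷_; _++_; map; filter; length; take; drop; upTo; applyUpTo; [_])
open import Data.List.Properties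
open import Data.List.Relation.Binary.Permutation.Propositional using (_↭_; ↭-sym; ↭-reflexive)
open import Data.List.Relation.Binary.Permutation.Propositional.Properties using (All-resp-↭; ↭-length)
open import Data.List.Relation.Unary.All as All using (All; []; _∷_)
open import Data.List.Relation.Unary.All.Properties using (map⁺; take⁺; drop⁺; ++⁺; applyUpTo⁺₁; ¬Any⇒All¬; All¬⇒¬Any)
open import Data.List.Relation.Unary.Any using (here; there)
open import Data.List.Relation.Unary.Unique.Propositional using (Unique; []; _∷_)
open import Data.Nat using (ℕ; zero; suc; _+_; _∸_; _<?_; _≤?_; _≟_; _≤_; _<_; z≤n; s≤s; s<s; s<s⁻¹)
open import Data.Nat.ListAction using (sum)
open import Data.Nat.Properties
open import Data.Nat.Tactic.RingSolver using (solve-∀)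
open import Data.List.Membership.DecPropositional _≟_ using (_∈_; _∉_; _∈?_; _∉?_)
open import Data.Product using (_,_)
open import Function using (_∘_; id)
open import Relation.Binary.Definitions using (tri<; tri≈; tri>)
open import Relation.Binary.PropositionalEquality hiding ([_])
open import Relation.Nullary using (Dec; yes; no; does; ¬_; contradiction)
open import Relation.Nullary.Decidable using (⌊_⌋)
open import Relation.Unary using (Decidable)
open import Relation.Unary.Properties using (∁?)

open import Defs

filter-comm : ∀ {A : Set} {P Q : A → Set} (P? : Decidable P) (Q? : Decidable Q) xs →
  filter P? (filter Q? xs) ≡ filter Q? (filter P? xs)
filter-comm P? Q? [] = refl
filter-comm P? Q? (x ∷ xs) with P? x | Q? x
... | yes p | yes q rewrite filter-accept P? {xs = filter Q? xs} p | filter-accept Q? {xs = filter P? xs} q =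
  cong (x ∷_) (filter-comm P? Q? xs)
... | yes p | no ¬q rewrite filter-reject Q? {xs = filter P? xs} ¬q = filter-comm P? Q? xs
... | no ¬p | yes q rewrite filter-reject P? {xs = filter Q? xs} ¬p = filter-comm P? Q? xs
... | no _ | no _ = filter-comm P? Q? xs

length-filter-∁ : ∀ {A : Set} {P : A → Set} (P? : Decidable P) xs →
  length (filter P? xs) + length (filter (∁? P?) xs) ≡ length xs
length-filter-∁ P? [] = refl
length-filter-∁ P? (x ∷ xs) with P? x
... | yes _ = cong suc (length-filter-∁ P? xs)
... | no _  = trans (+-suc _ _) (cong suc (length-filter-∁ P? xs))

length-filter-≤-< : ∀ i xs → length (filter (_≤? i) xs) + length (filter (i <?_) xs) ≡ length xs
length-filter-≤-< i xs = trans
  (cong (λ ys → length (filter (_≤? i) xs) + length ys) (filter-≐ (i <?_) (∁? (_≤? i)) (<⇒≱ , ≰⇒>) xs))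
  (length-filter-∁ (_≤? i) xs)

filter-≤-as-< : ∀ i → filter (_≤? i) ≗ filter (_<? suc i)
filter-≤-as-< i = filter-≐ (_≤? i) (_<? suc i) (s≤s , ≤-pred)

filter-<-upTo : ∀ {m n} → m ≤ n → filter (_<? m) (upTo n) ≡ upTo m
filter-<-upTo {m} {n} m≤n with m ≟ n
... | yes refl = filter-all (_<? m) (applyUpTo⁺₁ id m id)
filter-<-upTo {m} {suc n} m≤n | no m≢n = begin
  filter (_<? m) (upTo (suc n))                      ≡⟨ cong (filter (_<? m)) (sym (upTo-∷ʳ n)) ⟩
  filter (_<? m) (upTo n ++ [ n ])                   ≡⟨ filter-++ (_<? m) (upTo n) [ n ] ⟩
  filter (_<? m) (upTo n) ++ filter (_<? m) [ n ]    ≡⟨ cong (filter (_<? m) (upTo n) ++_) (filter-reject (_<? m) (≤⇒≯ m≤n′)) ⟩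
  filter (_<? m) (upTo n) ++ []                      ≡⟨ ++-identityʳ _ ⟩
  filter (_<? m) (upTo n)                            ≡⟨ filter-<-upTo m≤n′ ⟩
  upTo m                                             ∎
  where open ≡-Reasoning
        m≤n′ : m ≤ n
        m≤n′ = <⇒≤pred (≤∧≢⇒< m≤n m≢n)
filter-<-upTo {n = zero} z≤n | no m≢n = contradiction refl m≢n

length-filter-<-suc : ∀ m D →
  length (filter (_<? suc m) D) ≡ length (filter (_<? m) D) + length (filter (m ≟_) D)
length-filter-<-suc m [] = refl
length-filter-<-suc m (d ∷ D) with <-cmp d m
... | tri< d<m _ _ rewrite filter-accept (_<? suc m) {xs = D} (m≤n⇒m≤1+n d<m)
                         | filter-accept (_<? m) {xs = D} d<m
                         | filter-reject (m ≟_) {xs = D} (>⇒≢ d<m) = cong suc (length-filter-<-suc m D)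
... | tri≈ _ refl _ rewrite filter-accept (_<? suc d) {xs = D} (n<1+n d)
                         | filter-reject (_<? d) {xs = D} (n≮n d)
                         | filter-accept (d ≟_) {xs = D} refl =
  trans (cong suc (length-filter-<-suc d D)) (sym (+-suc _ _))
... | tri> _ _ m<d rewrite filter-reject (_<? suc m) {xs = D} (<⇒≱ m<d ∘ ≤-pred)
                         | filter-reject (_<? m) {xs = D} (<-asym m<d)
                         | filter-reject (m ≟_) {xs = D} (<⇒≢ m<d) = length-filter-<-suc m D

count-∈-unique : ∀ {m D} → Unique D → m ∈ D → length (filter (m ≟_) D) ≡ 1
count-∈-unique {m} {_ ∷ D} (m∉D ∷ _) (here refl) rewrite filter-accept (m ≟_) {xs = D} refl =
  cong (suc ∘ length) (filter-none (m ≟_) m∉D)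
count-∈-unique {m} {d ∷ D} (d∉D ∷ unique) (there m∈D) rewrite filter-reject (m ≟_) {xs = D} (≢-sym (All.lookup d∉D m∈D)) =
  count-∈-unique unique m∈D

count-unique : ∀ {D} → Unique D → ∀ m → length (filter (m ≟_) D) ≡ length (filter (_∈? D) [ m ])
count-unique {D} unique m with m ∈? D
... | yes m∈D = count-∈-unique unique m∈D
... | no m∉D  = cong length (filter-none (m ≟_) (¬Any⇒All¬ D m∉D))

length-filter-∈-upTo : ∀ {D} → Unique D → ∀ m → length (filter (_∈? D) (upTo m)) ≡ length (filter (_<? m) D)
length-filter-∈-upTo {D} unique zero = sym (cong length (filter-none (_<? 0) (All.universal (λ _ ()) D)))
length-filter-∈-upTo {D} unique (suc m) = begin
  length (filter (_∈? D) (upTo (suc m)))                             ≡⟨ cong (length ∘ filter (_∈? D)) (sym (upTo-∷ʳ m)) ⟩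
  length (filter (_∈? D) (upTo m ++ [ m ]))                          ≡⟨ cong length (filter-++ (_∈? D) (upTo m) [ m ]) ⟩
  length (filter (_∈? D) (upTo m) ++ filter (_∈? D) [ m ])           ≡⟨ length-++ (filter (_∈? D) (upTo m)) ⟩
  length (filter (_∈? D) (upTo m)) + length (filter (_∈? D) [ m ])  ≡⟨ cong₂ _+_ (length-filter-∈-upTo unique m) (sym (count-unique unique m)) ⟩
  length (filter (_<? m) D) + length (filter (m ≟_) D)               ≡⟨ sym (length-filter-<-suc m D) ⟩
  length (filter (_<? suc m) D)                                      ∎
  where open ≡-Reasoning

length-filter-≤-∈-∉ : ∀ {D} → Unique D → ∀ {i n} → i ≤ n →
  length (filter (_≤? i) D) + length (filter (_≤? i) (filter (_∉? D) (upTo (suc n)))) ≡ suc i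
length-filter-≤-∈-∉ {D} unique {i} {n} i≤n = begin
  length (filter (_≤? i) D) + length (filter (_≤? i) (filter (_∉? D) (upTo (suc n))))
    ≡⟨ cong₂ (λ xs ys → length xs + length ys) (filter-≤-as-< i D) non-members ⟩
  length (filter (_<? suc i) D) + length (filter (_∉? D) (upTo (suc i)))
    ≡⟨ cong (_+ length (filter (_∉? D) (upTo (suc i)))) (sym (length-filter-∈-upTo unique (suc i))) ⟩
  length (filter (_∈? D) (upTo (suc i))) + length (filter (_∉? D) (upTo (suc i)))
    ≡⟨ length-filter-∁ (_∈? D) (upTo (suc i)) ⟩
  length (upTo (suc i))
    ≡⟨ length-upTo (suc i) ⟩
  suc i ∎
  where
  open ≡-Reasoning
  non-members : filter (_≤? i) (filter (_∉? D) (upTo (suc n))) ≡ filter (_∉? D) (upTo (suc i))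
  non-members = begin
    filter (_≤? i) (filter (_∉? D) (upTo (suc n)))   ≡⟨ filter-comm (_≤? i) (_∉? D) (upTo (suc n)) ⟩
    filter (_∉? D) (filter (_≤? i) (upTo (suc n)))   ≡⟨ cong (filter (_∉? D)) (filter-≤-as-< i (upTo (suc n))) ⟩
    filter (_∉? D) (filter (_<? suc i) (upTo (suc n))) ≡⟨ cong (filter (_∉? D)) (filter-<-upTo (s≤s i≤n)) ⟩
    filter (_∉? D) (upTo (suc i))                     ∎

sum-map-suc : ∀ xs → sum (map suc xs) ≡ sum xs + length xs
sum-map-suc []       = refl
sum-map-suc (x ∷ xs) = begin
  suc x + sum (map suc xs)     ≡⟨ cong (suc x +_) (sum-map-suc xs) ⟩
  suc x + (sum xs + length xs) ≡⟨ cong suc (sym (+-assoc x (sum xs) (length xs))) ⟩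
  suc (x + sum xs + length xs) ≡⟨ sym (+-suc (x + sum xs) (length xs)) ⟩
  x + sum xs + suc (length xs) ∎
  where open ≡-Reasoning

insertAfter : ∀ {A : Set} → ℕ → A → List A → List A
insertAfter i x w = take i w ++ x ∷ drop i w

length-insertAfter : ∀ {A : Set} i (x : A) w → length (insertAfter i x w) ≡ suc (length w)
length-insertAfter zero    x w       = refl
length-insertAfter (suc i) x []      = refl
length-insertAfter (suc i) x (y ∷ w) = cong suc (length-insertAfter i x w)

filter-insertAfter-reject : ∀ {A : Set} {P : A → Set} (P? : Decidable P) i {x} w → ¬ P x → filter P? (insertAfter i x w) ≡ filter P? w
filter-insertAfter-reject P? zero    w       ¬Px = filter-reject P? ¬Px
filter-insertAfter-reject P? (suc i) []      ¬Px = filter-reject P? ¬Px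
filter-insertAfter-reject P? (suc i) (y ∷ w) ¬Px with does (P? y)
... | true  = cong (y ∷_) (filter-insertAfter-reject P? i w ¬Px)
... | false = filter-insertAfter-reject P? i w ¬Px

descentsFrom-descent : ∀ k {a b} w → b < a → descentsFrom k (a ∷ b ∷ w) ≡ k ∷ descentsFrom (suc k) (b ∷ w)
descentsFrom-descent k {a} {b} w b<a with b <? a
... | yes _   = refl
... | no b≮a = contradiction b<a b≮a

descentsFrom-ascent : ∀ k {a b} w → ¬ b < a → descentsFrom k (a ∷ b ∷ w) ≡ descentsFrom (suc k) (b ∷ w)
descentsFrom-ascent k {a} {b} w b≮a with b <? a
... | yes b<a = contradiction b<a b≮a
... | no _    = refl

-- In the recursions over a ∷ b ∷ w below, the recursive call is taken before splitting on b <? a: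
-- inside the with-branches the termination checker no longer sees b ∷ w as a subterm.
descentsFrom-map-suc : ∀ k w → descentsFrom k (map suc w) ≡ descentsFrom k w
descentsFrom-map-suc k []          = refl
descentsFrom-map-suc k (a ∷ [])    = refl
descentsFrom-map-suc k (a ∷ b ∷ w) with b <? a | descentsFrom-map-suc (suc k) (b ∷ w)
... | yes b<a | shifted rewrite descentsFrom-descent k (map suc w) (s<s b<a) = cong (k ∷_) shifted
... | no b≮a  | shifted rewrite descentsFrom-ascent k (map suc w) (b≮a ∘ s<s⁻¹) = shifted

descentsFrom-suc : ∀ k w → descentsFrom (suc k) w ≡ map suc (descentsFrom k w)
descentsFrom-suc k []          = refl
descentsFrom-suc k (a ∷ [])    = refl
descentsFrom-suc k (a ∷ b ∷ w) with b <? a | descentsFrom-suc (suc k) (b ∷ w)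
... | yes _ | shifted = cong (suc k ∷_) shifted
... | no _  | shifted = shifted

descentsFrom-≥ : ∀ k w → All (k ≤_) (descentsFrom k w)
descentsFrom-≥ zero    w = All.universal (λ _ → z≤n) (descentsFrom 0 w)
descentsFrom-≥ (suc k) w rewrite descentsFrom-suc k w = map⁺ (All.map s≤s (descentsFrom-≥ k w))

descentsFrom-unique : ∀ k w → Unique (descentsFrom k w)
descentsFrom-unique k []          = []
descentsFrom-unique k (a ∷ [])    = []
descentsFrom-unique k (a ∷ b ∷ w) with b <? a | descentsFrom-unique (suc k) (b ∷ w)
... | yes _ | unique = All.map <⇒≢ (descentsFrom-≥ (suc k) (b ∷ w)) ∷ unique
... | no _  | unique = unique

maj-map-suc : ∀ w → maj (map suc w) ≡ maj w
maj-map-suc w = cong sum (descentsFrom-map-suc 1 w)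

sub≥-map-suc : ∀ k w → sub≥ (suc k) (map suc w) ≡ map suc (sub≥ k w)
sub≥-map-suc k []      = refl
sub≥-map-suc k (x ∷ w) with k ≤? x
... | yes k≤x rewrite filter-accept (suc k ≤?_) {xs = map suc w} (s≤s k≤x) | filter-accept (k ≤?_) {xs = w} k≤x = cong (suc x ∷_) (sub≥-map-suc k w)
... | no k≰x  rewrite filter-reject (suc k ≤?_) {xs = map suc w} (k≰x ∘ ≤-pred) | filter-reject (k ≤?_) {xs = w} k≰x = sub≥-map-suc k w

ins1-positive : ∀ i β → All (1 ≤_) (ins1 i β)
ins1-positive i β = ++⁺ (take⁺ i shifted) (s≤s z≤n ∷ drop⁺ i shifted)
  where shifted = map⁺ (All.universal (λ _ → s≤s z≤n) β)

maj-sub≥-ins1 : ∀ k i β → maj (sub≥ (suc (suc k)) (ins1 i β)) ≡ maj (sub≥ (suc k) β)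
maj-sub≥-ins1 k i β = begin
  maj (sub≥ (suc (suc k)) (ins1 i β))    ≡⟨ cong maj (filter-insertAfter-reject (suc (suc k) ≤?_) i (map suc β) λ { (s≤s ()) }) ⟩
  maj (sub≥ (suc (suc k)) (map suc β))   ≡⟨ cong maj (sub≥-map-suc (suc k) β) ⟩
  maj (map suc (sub≥ (suc k) β))         ≡⟨ maj-map-suc (sub≥ (suc k) β) ⟩
  maj (sub≥ (suc k) β)                   ∎
  where open ≡-Reasoning

Mc-ins1 : ∀ i β → All (1 ≤_) β → Mc (ins1 i β) ≡ (maj (ins1 i β) ∸ maj β) ∷ Mc β
Mc-ins1 i β positive = begin
  Mc σ                                              ≡⟨ cong (map F ∘ applyUpTo suc) (length-insertAfter i 1 (map suc β)) ⟩
  map F (applyUpTo suc (suc (length (map suc β))))  ≡⟨ cong (λ m → map F (applyUpTo suc (suc m))) (length-map suc β) ⟩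
  F 1 ∷ map F (applyUpTo (suc ∘ suc) (length β))    ≡⟨ cong₂ _∷_ first-entry (remaining-entries (length β)) ⟩
  (maj σ ∸ maj β) ∷ Mc β                            ∎
  where
  open ≡-Reasoning
  σ = ins1 i β
  F G : ℕ → ℕ
  F j = maj (sub≥ j σ) ∸ maj (sub≥ (suc j) σ)
  G j = maj (sub≥ j β) ∸ maj (sub≥ (suc j) β)
  first-entry : F 1 ≡ maj σ ∸ maj β
  first-entry = cong₂ _∸_ (cong maj (filter-all (1 ≤?_) (ins1-positive i β)))
                          (trans (maj-sub≥-ins1 0 i β) (cong maj (filter-all (1 ≤?_) positive)))
  remaining-entries : ∀ m → map F (applyUpTo (suc ∘ suc) m) ≡ map G (applyUpTo suc m)
  remaining-entries m = begin
    map F (applyUpTo (suc ∘ suc) m)  ≡⟨ map-applyUpTo (suc ∘ suc) F m ⟩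
    applyUpTo (F ∘ suc ∘ suc) m      ≡⟨ sym (map-upTo (F ∘ suc ∘ suc) m) ⟩
    map (F ∘ suc ∘ suc) (upTo m)     ≡⟨ map-cong (λ k → cong₂ _∸_ (maj-sub≥-ins1 k i β) (maj-sub≥-ins1 (suc k) i β)) (upTo m) ⟩
    map (G ∘ suc) (upTo m)           ≡⟨ map-upTo (G ∘ suc) m ⟩
    applyUpTo (G ∘ suc) m            ≡⟨ sym (map-applyUpTo suc G m) ⟩
    map G (applyUpTo suc m)          ∎

ifMember : ℕ → List ℕ → ℕ
ifMember p D = if ⌊ p ∈? D ⌋ then p else 0

ifMember-∈ : ∀ {p D} → p ∈ D → ifMember p D ≡ p
ifMember-∈ {p} {D} p∈D with p ∈? D
... | yes _   = refl
... | no p∉D = contradiction p∈D p∉D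

ifMember-∉ : ∀ {p D} → p ∉ D → ifMember p D ≡ 0
ifMember-∉ {p} {D} p∉D with p ∈? D
... | yes p∈D = contradiction p∈D p∉D
... | no _    = refl

ifMember-∷-≢ : ∀ {p d} D → p ≢ d → ifMember p (d ∷ D) ≡ ifMember p D
ifMember-∷-≢ {p} {d} D p≢d = by-cases (p ∈? D)
  where
  by-cases : Dec (p ∈ D) → ifMember p (d ∷ D) ≡ ifMember p D
  by-cases (yes p∈D) = trans (ifMember-∈ {D = d ∷ D} (there p∈D)) (sym (ifMember-∈ p∈D))
  by-cases (no p∉D)  = trans (ifMember-∉ {D = d ∷ D} λ { (here p≡d) → p≢d p≡d ; (there p∈D) → p∉D p∈D }) (sym (ifMember-∉ p∉D))

sum-descentsFrom-∷-min : ∀ k {x} w → All (x <_) w →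
  sum (descentsFrom k (x ∷ w)) ≡ sum (descentsFrom k w) + length (descentsFrom k w)
sum-descentsFrom-∷-min k []      []          = refl
sum-descentsFrom-∷-min k (b ∷ w) (x<b ∷ _) rewrite descentsFrom-ascent k w (<-asym x<b) | descentsFrom-suc k (b ∷ w)
  = sum-map-suc (descentsFrom k (b ∷ w))

sum-descentsFrom-insertAfter-min : ∀ k j {x} w → All (x <_) w → j < length w →
  sum (descentsFrom k (insertAfter (suc j) x w)) + ifMember (k + j) (descentsFrom k w)
    ≡ sum (descentsFrom k w) + (k + j) + length (filter (k + j <?_) (descentsFrom k w))
sum-descentsFrom-insertAfter-min k zero (a ∷ []) (x<a ∷ []) _
  rewrite +-identityʳ k | descentsFrom-descent k [] x<a = +-identityʳ (k + 0)
sum-descentsFrom-insertAfter-min k zero {x} (a ∷ b ∷ w) (x<a ∷ x<bw) _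
  rewrite +-identityʳ k | descentsFrom-descent k (b ∷ w) x<a | sum-descentsFrom-∷-min (suc k) (b ∷ w) x<bw
  with b <? a
... | yes _ rewrite ifMember-∈ {k} {k ∷ descentsFrom (suc k) (b ∷ w)} (here refl)
                  | filter-reject (k <?_) {xs = descentsFrom (suc k) (b ∷ w)} (n≮n k)
                  | filter-all (k <?_) (descentsFrom-≥ (suc k) (b ∷ w)) = rearrange k (sum E) (length E)
  where E = descentsFrom (suc k) (b ∷ w)
        rearrange : ∀ k s l → k + (s + l) + k ≡ k + s + k + l
        rearrange = solve-∀
... | no _  rewrite ifMember-∉ {k} {descentsFrom (suc k) (b ∷ w)} (All¬⇒¬Any (All.map <⇒≢ (descentsFrom-≥ (suc k) (b ∷ w))))
                  | filter-all (k <?_) (descentsFrom-≥ (suc k) (b ∷ w)) = rearrange k (sum E) (length E)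
  where E = descentsFrom (suc k) (b ∷ w)
        rearrange : ∀ k s l → k + (s + l) + 0 ≡ s + k + l
        rearrange = solve-∀
sum-descentsFrom-insertAfter-min k (suc j) (a ∷ []) _ (s≤s ())
sum-descentsFrom-insertAfter-min k (suc j) {x} (a ∷ b ∷ w) (x<a ∷ x<bw) (s≤s j<len)
  rewrite +-suc k j
  with b <? a | sum-descentsFrom-insertAfter-min (suc k) j (b ∷ w) x<bw j<len
... | no _  | shifted = shifted
... | yes _ | shifted
  rewrite ifMember-∷-≢ {suc (k + j)} {k} (descentsFrom (suc k) (b ∷ w)) (>⇒≢ (s≤s (m≤m+n k j)))
        | filter-reject (suc (k + j) <?_) {xs = descentsFrom (suc k) (b ∷ w)} (<-asym (s≤s (m≤m+n k j))) = begin
  k + sum L + ifMember p E    ≡⟨ +-assoc k (sum L) (ifMember p E) ⟩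
  k + (sum L + ifMember p E)  ≡⟨ cong (k +_) shifted ⟩
  k + (sum E + p + F)         ≡⟨ sym (+-assoc k (sum E + p) F) ⟩
  k + (sum E + p) + F         ≡⟨ cong (_+ F) (sym (+-assoc k (sum E) p)) ⟩
  k + sum E + p + F           ∎
  where
  open ≡-Reasoning
  p = suc (k + j)
  E = descentsFrom (suc k) (b ∷ w)
  L = descentsFrom (suc k) (insertAfter (suc j) x (b ∷ w))
  F = length (filter (p <?_) E)

maj-ins1 : ∀ i β → All (1 ≤_) β → i ≤ length β →
  maj (ins1 i β) + ifMember i (descents β) ≡ maj β + i + length (filter (i <?_) (descents β))
maj-ins1 zero β positive _
  rewrite sum-descentsFrom-∷-min 1 (map suc β) (map⁺ (All.map s≤s positive))
        | descentsFrom-map-suc 1 β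
        | ifMember-∉ {0} {descents β} (All¬⇒¬Any (All.map <⇒≢ (descentsFrom-≥ 1 β)))
        | filter-all (0 <?_) (descentsFrom-≥ 1 β)
  = trans (+-identityʳ _) (cong (_+ des β) (sym (+-identityʳ (maj β))))
maj-ins1 (suc j) β positive j<len
  rewrite sym (descentsFrom-map-suc 1 β)
  = sum-descentsFrom-insertAfter-min 1 j (map suc β) (map⁺ (All.map s≤s positive)) (subst (j <_) (sym (length-map suc β)) j<len)

maj-ins1-∸-maj : ∀ i β → All (1 ≤_) β → i ≤ length β → maj (ins1 i β) ∸ maj β ≡ τM β i
maj-ins1-∸-maj i β positive i≤len with i ∈? descents β
... | yes i∈D = begin
  maj σ ∸ maj β      ≡⟨ cong (_∸ maj β) maj-σ ⟩
  maj β + b ∸ maj β  ≡⟨ m+n∸m≡n (maj β) b ⟩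
  b                  ≡⟨ sym (m+n∸m≡n a b) ⟩
  a + b ∸ a          ≡⟨ cong (_∸ a) (length-filter-≤-< i D) ⟩
  des β ∸ a          ∎
  where
  open ≡-Reasoning
  σ = ins1 i β
  D = descents β
  a = length (filter (_≤? i) D)
  b = length (filter (i <?_) D)
  maj-σ : maj σ ≡ maj β + b
  maj-σ = +-cancelʳ-≡ i (maj σ) (maj β + b) (begin
    maj σ + i              ≡⟨ cong (maj σ +_) (sym (ifMember-∈ i∈D)) ⟩
    maj σ + ifMember i D   ≡⟨ maj-ins1 i β positive i≤len ⟩
    maj β + i + b          ≡⟨ xy∙z≈xz∙y +-commutativeSemigroup (maj β) i b ⟩
    maj β + b + i          ∎)
... | no i∉D = begin
  maj σ ∸ maj β              ≡⟨ cong (_∸ maj β) maj-σ ⟩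
  maj β + (i + b) ∸ maj β    ≡⟨ m+n∸m≡n (maj β) (i + b) ⟩
  suc i + b ∸ 1              ≡⟨ cong (λ t → t + b ∸ 1) (sym (length-filter-≤-∈-∉ (descentsFrom-unique 1 β) i≤len)) ⟩
  a + r + b ∸ 1              ≡⟨ cong (_∸ 1) (xy∙z≈xz∙y +-commutativeSemigroup a r b) ⟩
  a + b + r ∸ 1              ≡⟨ cong (λ t → t + r ∸ 1) (length-filter-≤-< i D) ⟩
  des β + r ∸ 1              ∎
  where
  open ≡-Reasoning
  σ = ins1 i β
  D = descents β
  a = length (filter (_≤? i) D)
  b = length (filter (i <?_) D)
  r = length (filter (_≤? i) (rises β))
  maj-σ : maj σ ≡ maj β + (i + b)
  maj-σ = begin
    maj σ                  ≡⟨ sym (+-identityʳ (maj σ)) ⟩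
    maj σ + 0              ≡⟨ cong (maj σ +_) (sym (ifMember-∉ i∉D)) ⟩
    maj σ + ifMember i D   ≡⟨ maj-ins1 i β positive i≤len ⟩
    maj β + i + b          ≡⟨ +-assoc (maj β) i b ⟩
    maj β + (i + b)        ∎

mainTheorem11 : (n : ℕ) (β : List ℕ) → β ↭ idWord n → (i : ℕ) → i ≤ n →
    Mc (ins1 i β) ↭ (τM β i ∷ Mc β)
mainTheorem11 n β β↭id i i≤n = ↭-reflexive (begin
  Mc (ins1 i β)                     ≡⟨ Mc-ins1 i β positive ⟩
  (maj (ins1 i β) ∸ maj β) ∷ Mc β   ≡⟨ cong (_∷ Mc β) (maj-ins1-∸-maj i β positive i≤len) ⟩
  τM β i ∷ Mc β                     ∎)
  where
  open ≡-Reasoning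
  positive : All (1 ≤_) β
  positive = All-resp-↭ (↭-sym β↭id) (applyUpTo⁺₁ suc n (λ _ → s≤s z≤n))
  i≤len : i ≤ length β
  i≤len = subst (i ≤_) (sym (trans (↭-length β↭id) (length-applyUpTo suc n))) i≤n
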